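{- For all integers $r\ge 2$ and $n\ge 2$, \[\alpha(H_{n:r})\ge \alpha(H_{n-1:r})+\binom{n-1}{r}.\]
   Context: For positive integers $n,r$ write $[n]=\{1,\dots,n\}$. The Häggkvist–Hell graph $H_{n:r}$ is the graph whose vertices are the ordered pairs $(h,T)$ where $T$ is an $r$-element subset of $[n]$ and $h\in[n]\setminus T$; two vertices $(h_x,T_x)$ and $(h_y,T_y)$ are adjacent iff $h_x\in T_y$, $h_y\in T_x$ and $T_x\cap T_y=\varnothing$. $\alpha$ denotes the independence number (the independence number of a graph with no vertices is $0$). -}

module Defs where

open import Data.Nat using (ℕ; _≤_)
open import Data.Fin using (Fin)
open import Data.Fin.Subset using (Subset; _∈_; _∉_; _∩_; ∣_∣; Empty)
open import Data.Product using (_×_; Σ; _,_; ∃)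
open import Data.List using (List; length)
open import Data.List.Relation.Unary.All using (All)
open import Data.List.Relation.Unary.Unique.Propositional using (Unique)
import Data.List.Membership.Propositional as M
open import Relation.Binary.PropositionalEquality using (_≡_)
open import Relation.Nullary using (¬_)

-- A candidate vertex (h , T) of H_{n:r}: h ∈ [n] (as Fin n), T ⊆ [n] (as Subset n).
Pair : ℕ → Set
Pair n = Fin n × Subset n

IsVertex : (n r : ℕ) → Pair n → Set
IsVertex n r (h , T) = (∣ T ∣ ≡ r) × (h ∉ T)

Adj : {n : ℕ} → Pair n → Pair n → Set
Adj (hx , Tx) (hy , Ty) = (hx ∈ Ty) × (hy ∈ Tx) × Empty (Tx ∩ Ty)

-- An independent set of H_{n:r}, given as a duplicate-free list of vertices,
-- no two of which are adjacent.  Its size is the length of the list.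
IsIndependent : (n r : ℕ) → List (Pair n) → Set
IsIndependent n r S =
  All (IsVertex n r) S × Unique S ×
  (∀ {x y} → x M.∈ S → y M.∈ S → ¬ Adj x y)

IsIndependenceNumber : (n r k : ℕ) → Set
IsIndependenceNumber n r k =
  (Σ (List (Pair n)) λ S → IsIndependent n r S × length S ≡ k) ×
  (∀ S → IsIndependent n r S → length S ≤ k)

module Submission where

-- Write n = m + 1 and view [n] as Fin (suc m), with `zero` the new point and
-- `suc` embedding [m].  Given an independent set S of H_{m:r}, form
--
--   extend S = map lift S ++ map apex (subsetsOfSize m r),
--   lift (h , T) = (suc h , outside ∷ T),   apex T = (zero , outside ∷ T).
--
-- No set occurring in extend S contains the new point.  Adjacency of x and y
-- forces head x ∈ set y and head y ∈ set x, so an apex vertex (whose head is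
-- the new point) is adjacent to nothing in the list; and lifting reflects
-- adjacency, so the lifted copy of S stays independent.  Hence extend S is an
-- independent set of H_{n:r} of size |S| + C(m, r), and maximality of α(H_{n:r})
-- gives the bound.  The hypotheses r ≥ 2 and n ≥ 2 are only needed for n ≥ 1.

open import Defs
open import Data.Nat using (ℕ; _≤_; _≥_; _+_; _∸_; zero; suc; s≤s)
open import Data.Nat.Combinatorics using (_C_; nCk+nC[k+1]≡[n+1]C[k+1])
open import Data.Nat.Properties using (+-comm; ≤-trans; ≤-reflexive)
open import Data.Vec using ([]; _∷_)
open import Data.Vec.Properties using (∷-injectiveʳ)
open import Data.Fin using (zero; suc)
open import Data.Fin.Subset using (Subset; inside; outside; _∉_; ∣_∣)
open import Data.Fin.Subset.Properties using (drop-there; drop-∷-Empty)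
open import Data.Product using (_×_; _,_; proj₂)
open import Data.Sum using (inj₁; inj₂)
open import Data.List using (List; []; _∷_; map; _++_; length; [_])
open import Data.List.Properties using (length-map; length-++)
open import Data.List.Relation.Unary.All as All using (All)
import Data.List.Relation.Unary.All.Properties as All
open import Data.List.Relation.Unary.AllPairs using ([]; _∷_)
open import Data.List.Relation.Unary.Unique.Propositional using (Unique)
import Data.List.Relation.Unary.Unique.Propositional.Properties as Unique
import Data.List.Membership.Propositional as List
open import Data.List.Membership.Propositional.Properties using (∈-map⁻; ∈-++⁻)
open import Relation.Binary.PropositionalEquality
  using (_≡_; _≢_; refl; sym; trans; cong; cong₂; module ≡-Reasoning)
open import Relation.Nullary using (¬_)
open import Function using (_∘_)

unique-++-maps : ∀ {A₁ A₂ B : Set} {f : A₁ → B} {g : A₂ → B} {xs ys} →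
  (∀ {x y} → f x ≡ f y → x ≡ y) → (∀ {x y} → g x ≡ g y → x ≡ y) →
  (∀ x y → f x ≢ g y) → Unique xs → Unique ys → Unique (map f xs ++ map g ys)
unique-++-maps {f = f} {g} f-inj g-inj f≢g xs! ys! =
  Unique.++⁺ (Unique.map⁺ f-inj xs!) (Unique.map⁺ g-inj ys!) disjoint
  where
  disjoint : ∀ {v} → ¬ (v List.∈ map f _ × v List.∈ map g _)
  disjoint (v∈fxs , v∈gys) with ∈-map⁻ f v∈fxs | ∈-map⁻ g v∈gys
  ... | x , _ , refl | y , _ , fx≡gy = f≢g x y fx≡gy

subsetsOfSize : (m r : ℕ) → List (Subset m)
subsetsOfSize zero    zero    = [ [] ]
subsetsOfSize zero    (suc r) = []
subsetsOfSize (suc m) zero    = map (outside ∷_) (subsetsOfSize m zero)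
subsetsOfSize (suc m) (suc r) =
  map (outside ∷_) (subsetsOfSize m (suc r)) ++ map (inside ∷_) (subsetsOfSize m r)

length-subsetsOfSize : ∀ m r → length (subsetsOfSize m r) ≡ m C r
length-subsetsOfSize zero    zero    = refl
length-subsetsOfSize zero    (suc r) = refl
length-subsetsOfSize (suc m) zero    =
  trans (length-map (outside ∷_) (subsetsOfSize m zero)) (length-subsetsOfSize m zero)
length-subsetsOfSize (suc m) (suc r) = begin
  length (map (outside ∷_) without ++ map (inside ∷_) with′)
    ≡⟨ length-++ (map (outside ∷_) without) ⟩
  length (map (outside ∷_) without) + length (map (inside ∷_) with′)
    ≡⟨ cong₂ _+_ (trans (length-map _ without) (length-subsetsOfSize m (suc r)))
                 (trans (length-map _ with′) (length-subsetsOfSize m r)) ⟩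
  m C suc r + m C r
    ≡⟨ +-comm (m C suc r) (m C r) ⟩
  m C r + m C suc r
    ≡⟨ nCk+nC[k+1]≡[n+1]C[k+1] m r ⟩
  suc m C suc r ∎
  where
  open ≡-Reasoning
  without = subsetsOfSize m (suc r)
  with′   = subsetsOfSize m r

size-subsetsOfSize : ∀ m r → All (λ T → ∣ T ∣ ≡ r) (subsetsOfSize m r)
size-subsetsOfSize zero    zero    = refl All.∷ All.[]
size-subsetsOfSize zero    (suc r) = All.[]
size-subsetsOfSize (suc m) zero    = All.map⁺ (size-subsetsOfSize m zero)
size-subsetsOfSize (suc m) (suc r) =
  All.++⁺ (All.map⁺ (size-subsetsOfSize m (suc r)))
          (All.map⁺ (All.map (cong suc) (size-subsetsOfSize m r)))

unique-subsetsOfSize : ∀ m r → Unique (subsetsOfSize m r)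
unique-subsetsOfSize zero    zero    = All.[] ∷ []
unique-subsetsOfSize zero    (suc r) = []
unique-subsetsOfSize (suc m) zero    =
  Unique.map⁺ ∷-injectiveʳ (unique-subsetsOfSize m zero)
unique-subsetsOfSize (suc m) (suc r) =
  unique-++-maps ∷-injectiveʳ ∷-injectiveʳ (λ _ _ ())
                 (unique-subsetsOfSize m (suc r)) (unique-subsetsOfSize m r)

lift : ∀ {m} → Pair m → Pair (suc m)
lift (h , T) = suc h , outside ∷ T

apex : ∀ {m} → Subset m → Pair (suc m)
apex T = zero , outside ∷ T

lift-injective : ∀ {m} {x y : Pair m} → lift x ≡ lift y → x ≡ y
lift-injective {x = _ , _} {_ , _} refl = refl

apex-injective : ∀ {m} {T U : Subset m} → apex T ≡ apex U → T ≡ U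
apex-injective refl = refl

lift-isVertex : ∀ {m r} {x : Pair m} → IsVertex m r x → IsVertex (suc m) r (lift x)
lift-isVertex {x = h , T} (∣T∣≡r , h∉T) = ∣T∣≡r , λ sh∈ → h∉T (drop-there sh∈)

apex-isVertex : ∀ {m r} {T : Subset m} → ∣ T ∣ ≡ r → IsVertex (suc m) r (apex T)
apex-isVertex ∣T∣≡r = ∣T∣≡r , λ ()

lift-reflects-Adj : ∀ {m} {x y : Pair m} → Adj (lift x) (lift y) → Adj x y
lift-reflects-Adj {x = _ , _} {_ , _} (hx∈Ty , hy∈Tx , disjoint) =
  drop-there hx∈Ty , drop-there hy∈Tx , drop-∷-Empty disjoint

-- A vertex whose set avoids the new point is adjacent to no apex vertex,
-- in either order, since adjacency puts each head in the other's set.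
¬Adj-to-apex : ∀ {m} {x : Pair (suc m)} (T : Subset m) →
  zero ∉ proj₂ x → ¬ Adj x (apex T)
¬Adj-to-apex _ 0∉Tx (_ , 0∈Tx , _) = 0∉Tx 0∈Tx

¬Adj-from-apex : ∀ {m} {y : Pair (suc m)} (T : Subset m) →
  zero ∉ proj₂ y → ¬ Adj (apex T) y
¬Adj-from-apex _ 0∉Ty (0∈Ty , _) = 0∉Ty 0∈Ty

extend : ∀ {m} → ℕ → List (Pair m) → List (Pair (suc m))
extend {m} r S = map lift S ++ map apex (subsetsOfSize m r)

data ExtendMember {m : ℕ} (S : List (Pair m)) : Pair (suc m) → Set where
  lifted : ∀ {x} → x List.∈ S → ExtendMember S (lift x)
  apexed : ∀ T → ExtendMember S (apex T)

extend-member : ∀ {m} r (S : List (Pair m)) {x} → x List.∈ extend r S → ExtendMember S x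
extend-member r S x∈ with ∈-++⁻ (map lift S) x∈
... | inj₁ x∈lifted with ∈-map⁻ lift x∈lifted
...   | _ , x∈S , refl = lifted x∈S
extend-member r S x∈ | inj₂ x∈apexes with ∈-map⁻ apex x∈apexes
...   | T , _ , refl = apexed T

avoids-new-point : ∀ {m} {S : List (Pair m)} {x} → ExtendMember S x → zero ∉ proj₂ x
avoids-new-point (lifted _) ()
avoids-new-point (apexed _) ()

extend-independent : ∀ m r (S : List (Pair m)) →
  IsIndependent m r S → IsIndependent (suc m) r (extend r S)
extend-independent m r S (vertices , S! , S-indep) =
  All.++⁺ (All.map⁺ (All.map lift-isVertex vertices))
          (All.map⁺ (All.map apex-isVertex (size-subsetsOfSize m r))) ,
  unique-++-maps lift-injective apex-injective (λ _ _ ())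
                 S! (unique-subsetsOfSize m r) ,
  λ x∈ y∈ → nonadjacent (extend-member r S x∈) (extend-member r S y∈)
  where
  nonadjacent : ∀ {x y} → ExtendMember S x → ExtendMember S y → ¬ Adj x y
  nonadjacent x∈ (apexed T)  = ¬Adj-to-apex T (avoids-new-point x∈)
  nonadjacent (apexed T) y∈  = ¬Adj-from-apex T (avoids-new-point y∈)
  nonadjacent (lifted x∈S) (lifted y∈S) = S-indep x∈S y∈S ∘ lift-reflects-Adj

length-extend : ∀ {m} r (S : List (Pair m)) → length (extend r S) ≡ length S + m C r
length-extend {m} r S = begin
  length (map lift S ++ map apex (subsetsOfSize m r))
    ≡⟨ length-++ (map lift S) ⟩
  length (map lift S) + length (map apex (subsetsOfSize m r))
    ≡⟨ cong₂ _+_ (length-map lift S)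
                 (trans (length-map apex (subsetsOfSize m r)) (length-subsetsOfSize m r)) ⟩
  length S + m C r ∎
  where open ≡-Reasoning

mainTheorem10 : (r n : ℕ) → 2 ≤ r → 2 ≤ n → (a b : ℕ) →
    IsIndependenceNumber (n ∸ 1) r a → IsIndependenceNumber n r b →
    b ≥ a + (n ∸ 1) C r
mainTheorem10 r (suc m) _ (s≤s _) a b ((S , S-indep , |S|≡a) , _) (_ , b-maximal) =
  ≤-trans (≤-reflexive size) (b-maximal (extend r S) (extend-independent m r S S-indep))
  where
  size : a + m C r ≡ length (extend r S)
  size = sym (trans (length-extend r S) (cong (_+ m C r) |S|≡a))
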